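{- (i) There exists $\gamma\in\mathcal N$ belonging to neither one of $US^1_2$, $UP^1_2$ (i.e. $\neg(\gamma\in US^1_2)$ and $\neg(\gamma\in UP^1_2)$). (ii) There exists $\alpha\in\mathcal N$ belonging to neither one of $E^1_2$, $A^1_2$.
   Context: Framework: Brouwer's intuitionistic analysis (intuitionistic logic, countable choice, Brouwer's Continuity Principle, First and Second Axioms of Continuous Choice, Thesis on Bars, Fan Theorem); the Second Axiom of Continuous Choice says: if $\forall\alpha\exists\beta\,\alpha R\beta$ then there is a code $\gamma$ of a function $\mathcal N\to\mathcal N$ with $\forall\alpha\,\alpha R(\gamma|\alpha)$. $\mathcal N=\mathbb N^{\mathbb N}$; finite sequences coded by numbers, $\overline\alpha n$ initial part of length $n$, $\langle a,b\rangle$ (for numbers) the code of the two-element sequence; $\gamma^m(k)=\gamma(\langle m\rangle*k)$; functions $\mathcal N\to\mathcal N$ are codes $\gamma$ with each $\gamma^n$ satisfying $\forall\alpha\exists m\,\gamma^n(\overline\alpha m)\ne0$, $(\gamma|\alpha)(n)=p$ where the first nonzero $\gamma^n(\overline\alpha m)$ is $p+1$. $\langle\alpha,\beta\rangle(2n)=\alpha(n)$, $\langle\alpha,\beta\rangle(2n+1)=\beta(n)$; $\alpha_I(n)=\alpha(2n)$, $\alpha_{II}(n)=\alpha(2n+1)$; $Ex(X)=\{\alpha:\exists\beta\,\langle\alpha,\beta\rangle\in X\}$, $Un(X)=\{\alpha:\forall\beta\,\langle\alpha,\beta\rangle\in X\}$. For $\beta\in\mathcal N$: $F_\beta=\{\alpha:\forall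 n\,\beta(\overline\alpha n)=0\}$, $G_\beta=\{\alpha:\exists n\,\beta(\overline\alpha n)\ne0\}$, $A_\beta=Ex(F_\beta)$, $CA_\beta=Un(G_\beta)$, $PCA_\beta=Ex(CA_\beta)$, $CPA_\beta=Un(A_\beta)$. $US^1_2=\{\alpha:\alpha_{II}\in PCA_{\alpha_I}\}$, $UP^1_2=\{\alpha:\alpha_{II}\in CPA_{\alpha_I}\}$. $E^1_2=\{\alpha:\exists\beta\forall\gamma\exists n\,\alpha(\langle\overline\beta n,\overline\gamma n\rangle)\ne0\}$; $A^1_2=\{\alpha:\forall\beta\exists\gamma\forall n\,\alpha(\langle\overline\beta n,\overline\gamma n\rangle)=0\}$. -}

module Defs where

open import Level using (Level; _⊔_) renaming (suc to lsuc; zero to lzero)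
open import Data.Nat using (ℕ; zero; suc; _+_; _<_)
open import Data.Product using (Σ; _×_; _,_; proj₁; proj₂)
open import Data.List using (List; []; _∷_; _∷ʳ_; foldl)
open import Data.Empty using (⊥)
open import Relation.Nullary using (¬_)
open import Relation.Binary.PropositionalEquality using (_≡_; _≢_)

𝒩 : Set
𝒩 = ℕ → ℕ

-- Intuitionistic existence: (impredicatively encoded) propositional
-- truncation of Σ.  (Untruncated Σ would turn every ∀α∃β into a choice
-- function, and the continuity axioms below would then be inconsistent
-- with Agda's type theory, by Escardó–Xu.)

isProp : Set → Set
isProp P = (x y : P) → x ≡ y

∥_∥ : ∀ {ℓ} → Set ℓ → Set (ℓ ⊔ lsuc lzero)
∥ A ∥ = (P : Set) → isProp P → (A → P) → P

∃′ : ∀ {a b} (A : Set a) → (A → Set b) → Set (a ⊔ b ⊔ lsuc lzero)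
∃′ A B = ∥ Σ A B ∥

syntax ∃′ A (λ x → B) = ∃[ x ∈ A ] B

tri : ℕ → ℕ
tri zero    = zero
tri (suc n) = suc n + tri n

π : ℕ → ℕ → ℕ
π x y = tri (x + y) + y

-- inverse of π, by walking along the Cantor enumeration
nextPair : ℕ × ℕ → ℕ × ℕ
nextPair (zero  , y) = (suc y , zero)
nextPair (suc x , y) = (x , suc y)

unpair : ℕ → ℕ × ℕ
unpair zero    = (zero , zero)
unpair (suc n) = nextPair (unpair n)

-- Finite sequences: the empty sequence has code 0 and  s * ⟨x⟩  has code
-- suc (π s x).
_*⟨_⟩ : ℕ → ℕ → ℕ
s *⟨ x ⟩ = suc (π s x)

encode : List ℕ → ℕ
encode = foldl _*⟨_⟩ zero

decodeF : ℕ → ℕ → List ℕ   -- first argument is fuel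
decodeF zero    _       = []
decodeF (suc f) zero    = []
decodeF (suc f) (suc c) = decodeF f (proj₁ (unpair c)) ∷ʳ proj₂ (unpair c)

decode : ℕ → List ℕ
decode k = decodeF k k

⟨_⟩*_ : ℕ → ℕ → ℕ
⟨ m ⟩* k = encode (m ∷ decode k)

⟪_,_⟫ : ℕ → ℕ → ℕ
⟪ a , b ⟫ = (zero *⟨ a ⟩) *⟨ b ⟩

bar : 𝒩 → ℕ → ℕ
bar α zero    = zero
bar α (suc n) = bar α n *⟨ α n ⟩

⟨_,_⟩ : 𝒩 → 𝒩 → 𝒩
⟨ α , β ⟩ zero          = α zero
⟨ α , β ⟩ (suc zero)    = β zero
⟨ α , β ⟩ (suc (suc n)) = ⟨ (λ k → α (suc k)) , (λ k → β (suc k)) ⟩ n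

_I : 𝒩 → 𝒩
(α I) n = α (n + n)

_II : 𝒩 → 𝒩
(α II) n = α (suc (n + n))

Subset : Set₂
Subset = 𝒩 → Set₁

Ex : Subset → Subset
Ex X α = ∃[ β ∈ 𝒩 ] X ⟨ α , β ⟩

Un : Subset → Subset
Un X α = (β : 𝒩) → X ⟨ α , β ⟩

F : 𝒩 → 𝒩 → Set
F β α = (n : ℕ) → β (bar α n) ≡ 0

G : 𝒩 → Subset
G β α = ∃[ n ∈ ℕ ] (β (bar α n) ≢ 0)

Lift1 : (𝒩 → Set) → Subset
Lift1 X α = Level.Lift (lsuc lzero) (X α)

A : 𝒩 → Subset
A β = Ex (Lift1 (F β))

CA : 𝒩 → Subset
CA β = Un (G β)

PCA : 𝒩 → Subset
PCA β = Ex (CA β)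

CPA : 𝒩 → Subset
CPA β = Un (A β)

US¹₂ : Subset
US¹₂ α = PCA (α I) (α II)

UP¹₂ : Subset
UP¹₂ α = CPA (α I) (α II)

E¹₂ : Subset
E¹₂ α = ∃[ β ∈ 𝒩 ] ((γ : 𝒩) → ∃[ n ∈ ℕ ] (α ⟪ bar β n , bar γ n ⟫ ≢ 0))

A¹₂ : Subset
A¹₂ α = (β : 𝒩) → ∃[ γ ∈ 𝒩 ] ((n : ℕ) → α ⟪ bar β n , bar γ n ⟫ ≡ 0)

IsFun₀ : 𝒩 → Set₁
IsFun₀ φ = (α : 𝒩) → ∃[ m ∈ ℕ ] (φ (bar α m) ≢ 0)

-- φ(α) = p : the first nonzero value φ(ᾱm) is p+1
App₀ : 𝒩 → 𝒩 → ℕ → Set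
App₀ φ α p = Σ ℕ λ m → (φ (bar α m) ≡ suc p) × ((k : ℕ) → k < m → φ (bar α k) ≡ 0)

_^_ : 𝒩 → ℕ → 𝒩
(γ ^ m) k = γ (⟨ m ⟩* k)

IsFun : 𝒩 → Set₁
IsFun γ = (n : ℕ) → IsFun₀ (γ ^ n)

App : 𝒩 → 𝒩 → 𝒩 → Set
App γ α δ = (n : ℕ) → App₀ (γ ^ n) α (δ n)

-- The axioms of the framework (relations may be Set₁-valued so that
-- they can be instantiated by formulas containing ∃).

CountableChoice : Set₂
CountableChoice = (R : ℕ → 𝒩 → Set₁) →
  ((n : ℕ) → ∃[ α ∈ 𝒩 ] R n α) →
  ∃[ α ∈ 𝒩 ] ((n : ℕ) → R n (λ m → α (π n m)))

BCP : Set₂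
BCP = (R : 𝒩 → ℕ → Set₁) →
  ((α : 𝒩) → ∃[ n ∈ ℕ ] R α n) →
  (α : 𝒩) → ∃[ m ∈ ℕ ] ∃[ n ∈ ℕ ] ((β : 𝒩) → bar α m ≡ bar β m → R β n)

AC₁₀ : Set₂
AC₁₀ = (R : 𝒩 → ℕ → Set₁) →
  ((α : 𝒩) → ∃[ n ∈ ℕ ] R α n) →
  ∃[ φ ∈ 𝒩 ] (IsFun₀ φ × ((α : 𝒩) (p : ℕ) → App₀ φ α p → R α p))

AC₁₁ : Set₂
AC₁₁ = (R : 𝒩 → 𝒩 → Set₁) →
  ((α : 𝒩) → ∃[ β ∈ 𝒩 ] R α β) →
  ∃[ γ ∈ 𝒩 ] (IsFun γ × ((α δ : 𝒩) → App γ α δ → R α δ))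

-- Thesis on Bars, in the form of decidable bar induction:
-- if the decidable set B = {s | β s ≠ 0} is a bar in 𝒩, then ⟨⟩ belongs
-- to every C ⊇ B that is inductive.
ThesisOnBars : Set₂
ThesisOnBars = (β : 𝒩) →
  ((α : 𝒩) → ∃[ n ∈ ℕ ] (β (bar α n) ≢ 0)) →
  (C : ℕ → Set₁) →
  ((s : ℕ) → β s ≢ 0 → C s) →
  ((s : ℕ) → ((n : ℕ) → C (s *⟨ n ⟩)) → C s) →
  C zero

record Framework : Set₂ where
  field
    cc  : CountableChoice
    bcp : BCP
    ac10 : AC₁₀
    ac11 : AC₁₁
    bt  : ThesisOnBars

-- Both parts rest on one game: player I plays β, player II opens
-- with an answer to the question "is β identically zero?" (0 for yes,
-- k + 1 for "β k ≠ 0") and is penalised at the first move of I that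
-- contradicts it.  I cannot have a winning strategy, since whatever I
-- plays, the answer 0 fails only at some k with β k ≠ 0, and then k + 1
-- is never refuted.  II cannot have a winning strategy either, since one
-- would decide for every β whether β is zero, which Brouwer's Continuity
-- Principle forbids.  Coding the game by an α gives part (ii), and
-- coding it into the first half of a γ gives part (i).
module Submission where

open import Defs
open import Data.Product using (_×_)
open import Relation.Nullary using (¬_)

open import Level using (Lift; lift; lower)
open import Data.Nat using (ℕ; zero; suc; _+_; _*_; _∸_; _≤_; _<_; _≟_; z≤n; s≤s; pred)
open import Data.Nat.Properties
  using (+-suc; +-comm; +-identityʳ; ≤-refl; ≤-trans; m≤m+n; m≤n⇒m≤1+n; m∸n+n≡m; m≤n⇒m∸n≡0; m+n∸n≡m)
open import Data.Nat.GeneralisedArithmetic using (iterate)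
open import Data.Bool using (if_then_else_)
open import Data.Maybe using (Maybe; just; nothing)
import Data.Maybe as Maybe
open import Data.Product using (Σ; _,_; proj₁; proj₂)
open import Data.Empty using (⊥; ⊥-elim)
open import Function using (const)
open import Relation.Nullary using (does)
open import Relation.Nullary.Decidable using (dec-true; dec-false)
open import Relation.Binary.PropositionalEquality
  using (_≡_; _≢_; refl; sym; trans; cong; cong₂; subst; module ≡-Reasoning)

open ≡-Reasoning

∣_∣ : ∀ {a} {A : Set a} → A → ∥ A ∥
∣ x ∣ _ _ f = f x

∥∥-map : ∀ {a b} {A : Set a} {B : Set b} → (A → B) → ∥ A ∥ → ∥ B ∥
∥∥-map f h P isProp-P g = h P isProp-P (λ x → g (f x))

¬∥∥ : ∀ {a} {A : Set a} → ¬ A → ¬ ∥ A ∥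
¬∥∥ ¬x h = h ⊥ (λ ()) ¬x

tail : 𝒩 → 𝒩
tail α n = α (suc n)

⟨,⟩-I : ∀ (α β : 𝒩) n → (⟨ α , β ⟩ I) n ≡ α n
⟨,⟩-I α β zero    = refl
⟨,⟩-I α β (suc n) rewrite +-suc n n = ⟨,⟩-I (tail α) (tail β) n

⟨,⟩-even : ∀ (α β : 𝒩) n → ⟨ α , β ⟩ (n * 2) ≡ α n
⟨,⟩-even α β zero    = refl
⟨,⟩-even α β (suc n) = ⟨,⟩-even (tail α) (tail β) n

⟨,⟩-odd : ∀ (α β : 𝒩) n → ⟨ α , β ⟩ (suc (n * 2)) ≡ β n
⟨,⟩-odd α β zero    = refl
⟨,⟩-odd α β (suc n) = ⟨,⟩-odd (tail α) (tail β) n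

π-suc : ∀ x y → π x (suc y) ≡ suc (π (suc x) y)
π-suc x y rewrite +-suc x y = +-suc (tri (suc (x + y))) y

π-diagonal : ∀ n → π (suc n) 0 ≡ suc (π 0 n)
π-diagonal n rewrite +-identityʳ n | +-identityʳ (n + tri n) = cong suc (+-comm n (tri n))

-- Induction on y along the antidiagonal x + y, whose end is handled below.
unpair-π-antidiagonal : ∀ x y → unpair (π (x + y) 0) ≡ (x + y , 0) → unpair (π x y) ≡ (x , y)
unpair-π-antidiagonal x zero    e = subst (λ s → unpair (π s 0) ≡ (s , 0)) (+-identityʳ x) e
unpair-π-antidiagonal x (suc y) e = begin
  unpair (π x (suc y))          ≡⟨ cong unpair (π-suc x y) ⟩
  nextPair (unpair (π (suc x) y)) ≡⟨ cong nextPair (unpair-π-antidiagonal (suc x) y e′) ⟩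
  (x , suc y)                   ∎
  where e′ = subst (λ s → unpair (π s 0) ≡ (s , 0)) (+-suc x y) e

unpair-π-diagonal : ∀ n → unpair (π n 0) ≡ (n , 0)
unpair-π-diagonal zero    = refl
unpair-π-diagonal (suc n) = begin
  unpair (π (suc n) 0)      ≡⟨ cong unpair (π-diagonal n) ⟩
  nextPair (unpair (π 0 n)) ≡⟨ cong nextPair (unpair-π-antidiagonal 0 n (unpair-π-diagonal n)) ⟩
  (suc n , 0)               ∎

unpair-π : ∀ x y → unpair (π x y) ≡ (x , y)
unpair-π x y = unpair-π-antidiagonal x y (unpair-π-diagonal (x + y))

init : ℕ → ℕ
init c = proj₁ (unpair (pred c))

last : ℕ → ℕ
last c = proj₂ (unpair (pred c))

init-*⟨⟩ : ∀ s x → init (s *⟨ x ⟩) ≡ s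
init-*⟨⟩ s x = cong proj₁ (unpair-π s x)

last-*⟨⟩ : ∀ s x → last (s *⟨ x ⟩) ≡ x
last-*⟨⟩ s x = cong proj₂ (unpair-π s x)

-- The first argument is fuel; a code is never smaller than its length.
lengthF : ℕ → ℕ → ℕ
lengthF zero    _       = 0
lengthF (suc f) zero    = 0
lengthF (suc f) (suc c) = suc (lengthF f (proj₁ (unpair c)))

length : ℕ → ℕ
length c = lengthF c c

x≤π : ∀ x y → x ≤ π x y
x≤π x y = ≤-trans (m≤m+n x y) (≤-trans (n≤tri (x + y)) (m≤m+n (tri (x + y)) y))
  where
  n≤tri : ∀ n → n ≤ tri n
  n≤tri zero    = z≤n
  n≤tri (suc n) = s≤s (m≤m+n n (tri n))

n≤bar : ∀ (α : 𝒩) n → n ≤ bar α n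
n≤bar α zero    = z≤n
n≤bar α (suc n) = s≤s (≤-trans (n≤bar α n) (x≤π (bar α n) (α n)))

lengthF-bar : ∀ (α : 𝒩) {f} n → n ≤ f → lengthF f (bar α n) ≡ n
lengthF-bar α {zero}  zero    _         = refl
lengthF-bar α {suc f} zero    _         = refl
lengthF-bar α {suc f} (suc n) (s≤s n≤f) = cong suc (begin
  lengthF f (proj₁ (unpair (π (bar α n) (α n)))) ≡⟨ cong (λ p → lengthF f (proj₁ p)) (unpair-π (bar α n) (α n)) ⟩
  lengthF f (bar α n)                             ≡⟨ lengthF-bar α n n≤f ⟩
  n                                               ∎)

length-bar : ∀ (α : 𝒩) n → length (bar α n) ≡ n
length-bar α n = lengthF-bar α n (n≤bar α n)

iterate-init-bar : ∀ (α : 𝒩) k m → iterate init (bar α (k + m)) k ≡ bar α m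
iterate-init-bar α zero    m = refl
iterate-init-bar α (suc k) m = begin
  iterate init (init (bar α (suc (k + m)))) k ≡⟨ cong (λ c → iterate init c k) (init-*⟨⟩ (bar α (k + m)) (α (k + m))) ⟩
  iterate init (bar α (k + m)) k              ≡⟨ iterate-init-bar α k m ⟩
  bar α m                                     ∎

-- Positions are counted from 0 at the start of the sequence.
entry : ℕ → ℕ → ℕ
entry i c = last (iterate init c (length c ∸ suc i))

entry-bar : ∀ (α : 𝒩) {i n} → i < n → entry i (bar α n) ≡ α i
entry-bar α {i} {n} i<n = begin
  last (iterate init (bar α n) (length (bar α n) ∸ suc i)) ≡⟨ cong (λ l → last (iterate init (bar α n) (l ∸ suc i))) (length-bar α n) ⟩
  last (iterate init (bar α n) k)                          ≡⟨ cong (λ m → last (iterate init (bar α m) k)) (sym (m∸n+n≡m i<n)) ⟩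
  last (iterate init (bar α (k + suc i)) k)                ≡⟨ cong last (iterate-init-bar α k (suc i)) ⟩
  last (bar α (suc i))                                     ≡⟨ last-*⟨⟩ (bar α i) (α i) ⟩
  α i                                                      ∎
  where k = n ∸ suc i

bar-cong : ∀ {α β : 𝒩} n → (∀ k → k < n → α k ≡ β k) → bar α n ≡ bar β n
bar-cong zero    _     = refl
bar-cong (suc n) α≡β = cong₂ _*⟨_⟩ (bar-cong n (λ k k<n → α≡β k (m≤n⇒m≤1+n k<n))) (α≡β n ≤-refl)

Answers : 𝒩 → ℕ → Set
Answers β zero    = ∀ k → β k ≡ 0
Answers β (suc k) = β k ≢ 0

-- Nonzero iff the value b of β j refutes the answer c.
penalty : (j b c : ℕ) → ℕ
penalty _ zero    zero    = 0
penalty _ (suc _) zero    = 1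
penalty j zero    (suc k) = if does (j ≟ k) then 1 else 0
penalty _ (suc _) (suc _) = 0

answer-unpenalised : ∀ (β : 𝒩) c → Answers β c → ∀ j → penalty j (β j) c ≡ 0
answer-unpenalised β zero    β≡0  j rewrite β≡0 j = refl
answer-unpenalised β (suc k) βk≢0 j with β j in βj≡b
... | suc _ = refl
... | zero rewrite dec-false (j ≟ k) (λ { refl → βk≢0 βj≡b }) = refl

unpenalised-answer : ∀ (β : 𝒩) c → (∀ j → penalty j (β j) c ≡ 0) → Answers β c
unpenalised-answer β zero    unpenalised k with β k | unpenalised k
... | zero | _ = refl
unpenalised-answer β (suc k) unpenalised βk≡0 with β k | unpenalised k
... | zero | e rewrite dec-true (k ≟ k) refl with e
...   | ()

¬every-answer-refuted : ∀ (β : 𝒩) → ¬ ((c : ℕ) → ∥ Σ ℕ (λ j → penalty j (β j) c ≢ 0) ∥)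
¬every-answer-refuted β refuted =
  ¬∥∥ (λ { (j , 0-refuted) →
  ¬∥∥ (λ { (i , j+1-refuted) →
    j+1-refuted (answer-unpenalised β (suc j) (λ βj≡0 → 0-refuted (cong (λ b → penalty j b 0) βj≡0)) i) })
    (refuted (suc j)) })
    (refuted 0)

BCP⇒¬∀answer : BCP → ¬ ((β : 𝒩) → ∥ Σ ℕ (Answers β) ∥)
BCP⇒¬∀answer bcp answer =
  ¬∥∥ (λ { (m , h) → ¬∥∥ (λ { (c , H) → no-answer-near-0̄ m c (λ β agree → lower (H β agree)) }) h })
      (bcp (λ β c → Lift _ (Answers β c)) (λ β → ∥∥-map (λ { (c , a) → c , lift a }) (answer β)) (const 0))
  where
  no-answer-near-0̄ : ∀ m c → ((β : 𝒩) → bar (const 0) m ≡ bar β m → Answers β c) → ⊥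
  no-answer-near-0̄ m (suc k) H = H (const 0) refl refl
  no-answer-near-0̄ m zero    H = jump-at-m (H jump (bar-cong m (λ k k<m → sym (m≤n⇒m∸n≡0 k<m))) m)
    where
    -- 0̄ below m, but 1 at m.
    jump : 𝒩
    jump k = suc k ∸ m
    jump-at-m : jump m ≢ 0
    jump-at-m e with trans (sym (m+n∸n≡m 1 m)) e
    ... | ()

-- J β γ n ≠ 0 means that player I (playing β) has won against γ once n
-- moves have been made.
record Judges (J : 𝒩 → 𝒩 → ℕ → ℕ) : Set where
  field
    sound    : ∀ β γ n → J β γ n ≢ 0 → Σ ℕ (λ j → penalty j (β j) (γ 0) ≢ 0)
    complete : ∀ β γ j → Σ ℕ (λ n → J β γ n ≡ penalty j (β j) (γ 0))

module _ {J : 𝒩 → 𝒩 → ℕ → ℕ} (judges : Judges J) where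
  open Judges judges

  no-winning-strategy-for-I : ¬ ∃[ β ∈ 𝒩 ] ((γ : 𝒩) → ∃[ n ∈ ℕ ] (J β γ n ≢ 0))
  no-winning-strategy-for-I = ¬∥∥ λ { (β , win) →
    ¬every-answer-refuted β (λ c → ∥∥-map (λ { (n , J≢0) → sound β (const c) n J≢0 }) (win (const c))) }

  no-winning-strategy-for-II : BCP → ¬ ((β : 𝒩) → ∃[ γ ∈ 𝒩 ] ((n : ℕ) → J β γ n ≡ 0))
  no-winning-strategy-for-II bcp win = BCP⇒¬∀answer bcp λ β →
    ∥∥-map (λ { (γ , J≡0) → γ 0 , unpenalised-answer β (γ 0) λ j →
                 let (n , J≡penalty) = complete β γ j in trans (sym J≡penalty) (J≡0 n) })
           (win β)

penaltyAt : Maybe ℕ → (b c : ℕ) → ℕ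
penaltyAt nothing  _ _ = 0
penaltyAt (just j) b c = penalty j b c

previous : ℕ → Maybe ℕ
previous zero    = nothing
previous (suc j) = just j

-- At ⟪ ᾱ(j+1) , γ̄(j+1) ⟫ the step j of the game is judged.
αE : 𝒩
αE c = penaltyAt (previous (length t)) (last (last (init c))) (entry 0 t)
  where t = last c

αE-⟪⟫ : ∀ s t → αE ⟪ s , t ⟫ ≡ penaltyAt (previous (length t)) (last s) (entry 0 t)
αE-⟪⟫ s t rewrite last-*⟨⟩ (zero *⟨ s ⟩) t | init-*⟨⟩ (zero *⟨ s ⟩) t | last-*⟨⟩ zero s = refl

αE-bar : ∀ (β γ : 𝒩) j → αE ⟪ bar β (suc j) , bar γ (suc j) ⟫ ≡ penalty j (β j) (γ 0)
αE-bar β γ j = begin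
  αE ⟪ bar β (suc j) , bar γ (suc j) ⟫
    ≡⟨ αE-⟪⟫ (bar β (suc j)) (bar γ (suc j)) ⟩
  penaltyAt (previous (length (bar γ (suc j)))) (last (bar β (suc j))) (entry 0 (bar γ (suc j)))
    ≡⟨ cong (λ l → penaltyAt (previous l) (last (bar β (suc j))) (entry 0 (bar γ (suc j)))) (length-bar γ (suc j)) ⟩
  penalty j (last (bar β (suc j))) (entry 0 (bar γ (suc j)))
    ≡⟨ cong₂ (penalty j) (last-*⟨⟩ (bar β j) (β j)) (entry-bar γ {0} {suc j} (s≤s z≤n)) ⟩
  penalty j (β j) (γ 0)
    ∎

αE-judges : Judges (λ β γ n → αE ⟪ bar β n , bar γ n ⟫)
αE-judges = record { sound = sound ; complete = λ β γ j → suc j , αE-bar β γ j }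
  where
  sound : ∀ β γ n → αE ⟪ bar β n , bar γ n ⟫ ≢ 0 → Σ ℕ (λ j → penalty j (β j) (γ 0) ≢ 0)
  sound β γ zero    αE≢0 = ⊥-elim (αE≢0 (αE-⟪⟫ 0 0))
  sound β γ (suc j) αE≢0 = j , λ penalty≡0 → αE≢0 (trans (αE-bar β γ j) penalty≡0)

-- In ζ = ⟨ ⟨ τ , δ ⟩ , ε ⟩ we have ζ 1 = ε 0 and ζ (4j + 2) = δ j; step j
-- is judged once ζ̄(4j + 3) is known.
stepAt : ℕ → Maybe ℕ
stepAt 0 = nothing
stepAt 1 = nothing
stepAt 2 = nothing
stepAt 3 = just 0
stepAt (suc (suc (suc (suc n)))) = Maybe.map suc (stepAt n)

stepAt-judged : ∀ j → stepAt (3 + j * 2 * 2) ≡ just j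
stepAt-judged zero    = refl
stepAt-judged (suc j) = cong (Maybe.map suc) (stepAt-judged j)

stepAt-just : ∀ n {j} → stepAt n ≡ just j → n ≡ 3 + j * 2 * 2
stepAt-just 3 refl = refl
stepAt-just (suc (suc (suc (suc n)))) e with stepAt n in e′
stepAt-just (suc (suc (suc (suc n)))) refl | just i = cong (4 +_) (stepAt-just n e′)

ρ : 𝒩
ρ c = penaltyAt (stepAt (length c)) (last c) (entry 1 c)

module _ (τ δ ε : 𝒩) where
  private
    ζ : 𝒩
    ζ = ⟨ ⟨ τ , δ ⟩ , ε ⟩

  ρ-bar : ∀ n → ρ (bar ζ n) ≡ penaltyAt (stepAt n) (last (bar ζ n)) (entry 1 (bar ζ n))
  ρ-bar n = cong (λ l → penaltyAt (stepAt l) (last (bar ζ n)) (entry 1 (bar ζ n))) (length-bar ζ n)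

  ρ-bar-judged : ∀ j → ρ (bar ζ (3 + j * 2 * 2)) ≡ penalty j (δ j) (ε 0)
  ρ-bar-judged j = begin
    ρ (bar ζ n)
      ≡⟨ ρ-bar n ⟩
    penaltyAt (stepAt n) (last (bar ζ n)) (entry 1 (bar ζ n))
      ≡⟨ cong (λ s → penaltyAt s (last (bar ζ n)) (entry 1 (bar ζ n))) (stepAt-judged j) ⟩
    penalty j (last (bar ζ n)) (entry 1 (bar ζ n))
      ≡⟨ cong₂ (penalty j) ζ̄n-ends-with-δj (entry-bar ζ {1} {n} (s≤s (s≤s z≤n))) ⟩
    penalty j (δ j) (ε 0)
      ∎
    where
    n = 3 + j * 2 * 2
    ζ̄n-ends-with-δj : last (bar ζ n) ≡ δ j
    ζ̄n-ends-with-δj = begin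
      last (bar ζ n)           ≡⟨ last-*⟨⟩ (bar ζ (suc (suc (j * 2 * 2)))) _ ⟩
      ζ (suc (j * 2) * 2)      ≡⟨ ⟨,⟩-even ⟨ τ , δ ⟩ ε (suc (j * 2)) ⟩
      ⟨ τ , δ ⟩ (suc (j * 2))  ≡⟨ ⟨,⟩-odd τ δ j ⟩
      δ j                      ∎

ρ-judges : ∀ τ → Judges (λ δ ε n → ρ (bar ⟨ ⟨ τ , δ ⟩ , ε ⟩ n))
ρ-judges τ = record
  { sound    = sound
  ; complete = λ δ ε j → 3 + j * 2 * 2 , ρ-bar-judged τ δ ε j
  }
  where
  sound : ∀ δ ε n → ρ (bar ⟨ ⟨ τ , δ ⟩ , ε ⟩ n) ≢ 0 → Σ ℕ (λ j → penalty j (δ j) (ε 0) ≢ 0)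
  sound δ ε n ρ≢0 with stepAt n in e
  ... | nothing = ⊥-elim (ρ≢0 (trans (ρ-bar τ δ ε n) (cong (λ s → penaltyAt s (last (bar ⟨ ⟨ τ , δ ⟩ , ε ⟩ n)) (entry 1 (bar ⟨ ⟨ τ , δ ⟩ , ε ⟩ n))) e)))
  ... | just j  = j , λ penalty≡0 → ρ≢0 (begin
    ρ (bar ⟨ ⟨ τ , δ ⟩ , ε ⟩ n)               ≡⟨ cong (λ m → ρ (bar ⟨ ⟨ τ , δ ⟩ , ε ⟩ m)) (stepAt-just n e) ⟩
    ρ (bar ⟨ ⟨ τ , δ ⟩ , ε ⟩ (3 + j * 2 * 2)) ≡⟨ ρ-bar-judged τ δ ε j ⟩
    penalty j (δ j) (ε 0)                     ≡⟨ penalty≡0 ⟩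
    0                                         ∎)

Judges-resp : ∀ {J J′ : 𝒩 → 𝒩 → ℕ → ℕ} → (∀ β γ n → J β γ n ≡ J′ β γ n) → Judges J → Judges J′
Judges-resp J≡J′ judges = record
  { sound    = λ β γ n J′≢0 → sound β γ n (λ J≡0 → J′≢0 (trans (sym (J≡J′ β γ n)) J≡0))
  ; complete = λ β γ j → let (n , J≡penalty) = complete β γ j in n , trans (sym (J≡J′ β γ n)) J≡penalty
  }
  where open Judges judges

γ₀ : 𝒩
γ₀ = ⟨ ρ , const 0 ⟩

γ₀-judges : Judges (λ δ ε n → (γ₀ I) (bar ⟨ ⟨ γ₀ II , δ ⟩ , ε ⟩ n))
γ₀-judges = Judges-resp (λ δ ε n → sym (⟨,⟩-I ρ (const 0) (bar ⟨ ⟨ γ₀ II , δ ⟩ , ε ⟩ n))) (ρ-judges (γ₀ II))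

theorem9p9 : Framework →
    (∃[ γ ∈ 𝒩 ] (¬ US¹₂ γ × ¬ UP¹₂ γ)) × (∃[ α ∈ 𝒩 ] (¬ E¹₂ α × ¬ A¹₂ α))
theorem9p9 framework =
  ∣ γ₀ , no-winning-strategy-for-I γ₀-judges
       , (λ up → no-winning-strategy-for-II γ₀-judges bcp λ δ → ∥∥-map (λ { (ε , F) → ε , lower F }) (up δ)) ∣ ,
  ∣ αE , no-winning-strategy-for-I αE-judges , no-winning-strategy-for-II αE-judges bcp ∣
  where open Framework framework using (bcp)
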